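{- Let $M$ be the umbra defined by $e^{Mz}=e^{z^2/2}$, i.e. $\operatorname{eval}(M^n)=\frac{(2k)!}{2^k k!}$ if $n=2k$ and $\operatorname{eval}(M^n)=0$ if $n$ is odd. Then for every admissible formal power series $f$, $$e^{M^2z}f(M)=\frac{1}{\sqrt{1-2z}}\,f\!\left(\frac{M}{\sqrt{1-2z}}\right).$$
   Context: Let $R=\mathbb{Q}[[x,y,z,\dots]]$ be a ring of formal power series in several variables. A formal power series $f(t)=\sum_{n\ge0}f_nt^n$ with $f_n\in R$ is admissible if for every monomial $x^iy^jz^k\cdots$ the coefficient of that monomial in $f_n$ is nonzero for only finitely many $n$. The umbral evaluation $\operatorname{eval}$ is the $R$-linear functional on polynomials in the umbra $M$ with coefficients in $R$ determined by the values $\operatorname{eval}(M^n)$, extended to admissible series $\sum_n c_nM^n$ by $\sum_n c_n\operatorname{eval}(M^n)$. An identity $F(M)=G(M)$ means $\operatorname{eval}(F(M))=\operatorname{eval}(G(M))$; here $z$ is one of the variables of $R$ and $\sqrt{1-2z}$ is the power series with constant term $1$. -}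

module Defs where

open import Data.Nat as ℕ using (ℕ; zero; suc; _∸_; _≤_; _!; _%_; _^_)
open import Data.Nat.Properties using (_!≢0; m*n≢0; m^n≢0)
open import Data.Fin using (Fin)
open import Data.Integer using (+_)
open import Data.Rational using (ℚ; 0ℚ; 1ℚ; _+_; _*_; _-_; _/_)
open import Data.Product using (Σ)
open import Relation.Binary.PropositionalEquality using (_≡_)
open import Relation.Nullary using (yes; no)

sumTo : ℕ → (ℕ → ℚ) → ℚ
sumTo zero    g = 0ℚ
sumTo (suc n) g = sumTo n g + g n

-- Power series in the single variable z over ℚ:  coefficient of z^l.

PS : Set
PS = ℕ → ℚ

_⊛_ : PS → PS → PS
(g ⊛ h) a = sumTo (suc a) (λ i → g i * h (a ∸ i))

psOne : PS
psOne zero    = 1ℚ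
psOne (suc _) = 0ℚ

oneMinus2z : PS
oneMinus2z zero          = 1ℚ
oneMinus2z (suc zero)    = + 2 / 1 * (0ℚ - 1ℚ)
oneMinus2z (suc (suc _)) = 0ℚ

psPow : PS → ℕ → PS
psPow g zero    = psOne
psPow g (suc n) = g ⊛ psPow g n

-- The coefficient ring R = ℚ[[z, x₁, …, xₘ]].
-- An element r : R m is its coefficient function:
--   r a α = coefficient of  z^a · x₁^(α 1) ⋯ xₘ^(α m).

R : ℕ → Set
R m = ℕ → (Fin m → ℕ) → ℚ

zmul : ∀ {m} → PS → R m → R m
zmul g r a α = sumTo (suc a) (λ i → g i * r (a ∸ i) α)

-- Formal power series in t (equivalently, umbral series in M) with
-- coefficients in R:  f n = f_n, the coefficient of t^n (resp. M^n).

USeries : ℕ → Set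
USeries m = ℕ → R m

Admissible : ∀ {m} → USeries m → Set
Admissible f = ∀ a α → Σ ℕ (λ N → ∀ n → N ≤ n → f n a α ≡ 0ℚ)

momEven : ℕ → ℚ
momEven k = (+ ((2 ℕ.* k) !)) / (2 ^ k ℕ.* k !)
  where instance _ = m*n≢0 (2 ^ k) (k !) {{m^n≢0 2 k}} {{k !≢0}}

evalM : ℕ → ℚ
evalM n with n % 2
... | zero  = momEven (n ℕ./ 2)
... | suc _ = 0ℚ

-- umbral evaluation of an admissible series  Σ_n c_n M^n  (coefficientwise:
-- the sum Σ_n c_n eval(M^n) is finite at each monomial thanks to the bound).
eval : ∀ {m} (c : USeries m) → Admissible c → R m
eval c adm a α = sumTo (Σ.proj₁ (adm a α)) (λ n → c n a α * evalM n)

-- e^{M² z} = Σ_j z^j M^{2j} / j!  as a series in M whose coefficients are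
-- power series in z:  coefficient of M^k z^l is 1/l! if k = 2l, else 0.

expM2z : ℕ → PS
expM2z k l with k ℕ.≟ 2 ℕ.* l
... | yes _ = (+ 1) / (l !)  where instance _ = l !≢0
... | no  _ = 0ℚ

_⋆_ : ∀ {m} → (ℕ → PS) → USeries m → USeries m
(E ⋆ f) k = λ a α → sumTo (suc k) (λ i → zmul (E i) (f (k ∸ i)) a α)

-- f(M · t) · t  for a z-series t (used with t = 1/√(1-2z)):
-- the series whose M^n coefficient is  t · t^n · f_n.
scaledSeries : ∀ {m} → PS → USeries m → USeries m
scaledSeries t f n = zmul t (zmul (psPow t n) (f n))

-- Both evaluations, read off at a monomial z^a x^α, equal
--   Σ_{l ≤ a} Σ_n [z^(a-l) x^α] f_n · eval(M^(2l+n)) / l!.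
-- On the left this is just the expansion of e^{M²z} = Σ_l z^l M^(2l) / l!.  On the right,
-- t = 1/√(1-2z) satisfies t' = t³ (differentiate s² = 1 - 2z and t s = 1), so
-- (t^(n+1))' = (n+1) t^(n+3) and l! [z^l] t^(n+1) = (n+1)(n+3)⋯(n+2l-1); the moment recursion
-- eval(M^(n+2)) = (n+1) eval(M^n) turns this product times eval(M^n) into eval(M^(2l+n)).

module Submission where

open import Data.Empty using (⊥-elim)
open import Data.Fin using (Fin)
open import Data.Integer as ℤ using (+_)
import Data.Integer.Properties as ℤₚ
open import Data.Nat as ℕ using (ℕ; zero; suc; NonZero; _≤_; _<_; _∸_; z≤n; s≤s; _!; _^_; _⊔_)
import Data.Nat.Properties as ℕₚ
open import Data.Nat.DivMod using (m*n%n≡0; m*n/n≡m; [m+kn]%n≡m%n)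
import Data.Nat.Solver as ℕ-Solver
open import Data.Product using (Σ; _,_; proj₁; proj₂)
open import Data.Rational using (ℚ; 0ℚ; 1ℚ; _+_; _*_; -_; _/_; toℚᵘ)
open import Data.Rational.Properties
  using (toℚᵘ-injective; toℚᵘ-fromℚᵘ; toℚᵘ-homo-*; toℚᵘ-homo-+; +-identityˡ; +-identityʳ;
         *-identityˡ; *-identityʳ; *-zeroˡ; *-zeroʳ; *-distribˡ-+; *-distribʳ-+; +-assoc; +-comm; *-comm; *-assoc)
import Data.Rational.Unnormalised as ℚᵘ
import Data.Rational.Unnormalised.Properties as ℚᵘₚ
open import Data.Rational.Solver using (module +-*-Solver)
open import Data.Sum using (_⊎_; inj₁; inj₂)
open import Function using (_∘_)
open import Relation.Binary.PropositionalEquality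
open import Relation.Nullary using (Dec; yes; no)

open import Defs

fromℕ : ℕ → ℚ
fromℕ n = + n / 1

toℚᵘ-/ : ∀ p q .{{_ : NonZero q}} → toℚᵘ (+ p / q) ℚᵘ.≃ ℚᵘ.mkℚᵘ (+ p) (ℕ.pred q)
toℚᵘ-/ p (suc q) = toℚᵘ-fromℚᵘ (ℚᵘ.mkℚᵘ (+ p) q)

/-cross : ∀ a b c d .{{_ : NonZero b}} .{{_ : NonZero d}} →
          a ℕ.* d ≡ c ℕ.* b → + a / b ≡ + c / d
/-cross a b@(suc _) c d@(suc _) ad≡cb = toℚᵘ-injective
  (ℚᵘₚ.≃-trans (toℚᵘ-/ a b) (ℚᵘₚ.≃-trans (ℚᵘ.*≡* cross) (ℚᵘₚ.≃-sym (toℚᵘ-/ c d))))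
  where
  cross : + a ℤ.* + d ≡ + c ℤ.* + b
  cross = trans (sym (ℤₚ.pos-* a d)) (trans (cong +_ ad≡cb) (ℤₚ.pos-* c b))

/-* : ∀ a b c d .{{_ : NonZero b}} .{{_ : NonZero d}} →
      (+ a / b) * (+ c / d) ≡ (+ (a ℕ.* c) / (b ℕ.* d)) {{ℕₚ.m*n≢0 b d}}
/-* a b@(suc _) c d@(suc _) = toℚᵘ-injective
  (ℚᵘₚ.≃-trans (toℚᵘ-homo-* (+ a / b) (+ c / d))
  (ℚᵘₚ.≃-trans (ℚᵘₚ.*-cong (toℚᵘ-/ a b) (toℚᵘ-/ c d))
  (ℚᵘₚ.≃-trans (ℚᵘ.*≡* (cong (ℤ._* + (b ℕ.* d)) (sym (ℤₚ.pos-* a c))))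
               (ℚᵘₚ.≃-sym (toℚᵘ-/ (a ℕ.* c) (b ℕ.* d))))))

/-+ : ∀ a b c d .{{_ : NonZero b}} .{{_ : NonZero d}} →
      (+ a / b) + (+ c / d) ≡ (+ (a ℕ.* d ℕ.+ c ℕ.* b) / (b ℕ.* d)) {{ℕₚ.m*n≢0 b d}}
/-+ a b@(suc _) c d@(suc _) = toℚᵘ-injective
  (ℚᵘₚ.≃-trans (toℚᵘ-homo-+ (+ a / b) (+ c / d))
  (ℚᵘₚ.≃-trans (ℚᵘₚ.+-cong (toℚᵘ-/ a b) (toℚᵘ-/ c d))
  (ℚᵘₚ.≃-trans (ℚᵘ.*≡* (cong (ℤ._* + (b ℕ.* d)) numerator))
               (ℚᵘₚ.≃-sym (toℚᵘ-/ (a ℕ.* d ℕ.+ c ℕ.* b) (b ℕ.* d))))))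
  where
  numerator : + a ℤ.* + d ℤ.+ + c ℤ.* + b ≡ + (a ℕ.* d ℕ.+ c ℕ.* b)
  numerator = sym (trans (ℤₚ.pos-+ (a ℕ.* d) (c ℕ.* b))
                         (cong₂ ℤ._+_ (ℤₚ.pos-* a d) (ℤₚ.pos-* c b)))

fromℕ-+ : ∀ m n → fromℕ (m ℕ.+ n) ≡ fromℕ m + fromℕ n
fromℕ-+ m n = sym (trans (/-+ m 1 n 1) (/-cross (m ℕ.* 1 ℕ.+ n ℕ.* 1) 1 (m ℕ.+ n) 1
  (solve 2 (λ m n → (m :* con 1 :+ n :* con 1) :* con 1 := (m :+ n) :* con 1) refl m n)))
  where open ℕ-Solver.+-*-Solver

fromℕ-* : ∀ m n → fromℕ (m ℕ.* n) ≡ fromℕ m * fromℕ n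
fromℕ-* m n = sym (trans (/-* m 1 n 1) (/-cross (m ℕ.* n) 1 (m ℕ.* n) 1 refl))

invFactorial : ℕ → ℚ
invFactorial l = (+ 1 / l !) {{l ℕₚ.!≢0}}

invFactorial-inverseˡ : ∀ l → invFactorial l * fromℕ (l !) ≡ 1ℚ
invFactorial-inverseˡ l = trans (/-* 1 (l !) (l !) 1 {{l ℕₚ.!≢0}})
  (/-cross (1 ℕ.* l !) (l ! ℕ.* 1) 1 1 {{ℕₚ.m*n≢0 (l !) 1 {{l ℕₚ.!≢0}}}}
    (ℕₚ.*-assoc 1 (l !) 1))

momEven-suc : ∀ k → momEven (suc k) ≡ fromℕ (suc (2 ℕ.* k)) * momEven k
momEven-suc k = sym (trans (/-* (suc (2 ℕ.* k)) 1 ((2 ℕ.* k) !) (2 ^ k ℕ.* k !) {{_}} {{denominator≢0 k}})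
  (/-cross (suc (2 ℕ.* k) ℕ.* (2 ℕ.* k) !) (1 ℕ.* (2 ^ k ℕ.* k !)) ((2 ℕ.* suc k) !) (2 ^ suc k ℕ.* suc k !)
           {{ℕₚ.m*n≢0 1 (2 ^ k ℕ.* k !) {{_}} {{denominator≢0 k}}}} {{denominator≢0 (suc k)}}
           (trans cross (cong (λ x → x ! ℕ.* (1 ℕ.* (2 ^ k ℕ.* k !))) (sym (ℕₚ.*-suc 2 k))))))
  where
  open ℕ-Solver.+-*-Solver
  denominator≢0 : ∀ k → NonZero (2 ^ k ℕ.* k !)
  denominator≢0 k = ℕₚ.m*n≢0 (2 ^ k) (k !) {{ℕₚ.m^n≢0 2 k}} {{k ℕₚ.!≢0}}
  cross : suc (2 ℕ.* k) ℕ.* (2 ℕ.* k) ! ℕ.* (2 ^ suc k ℕ.* suc k !)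
        ≡ (2 ℕ.+ 2 ℕ.* k) ! ℕ.* (1 ℕ.* (2 ^ k ℕ.* k !))
  cross = solve 4 (λ k F P K → (con 1 :+ con 2 :* k) :* F :* ((con 2 :* P) :* ((con 1 :+ k) :* K))
                             := ((con 2 :+ con 2 :* k) :* ((con 1 :+ con 2 :* k) :* F)) :* (con 1 :* (P :* K)))
                  refl k ((2 ℕ.* k) !) (2 ^ k) (k !)

evalM-even : ∀ n → n ℕ.% 2 ≡ 0 → evalM n ≡ momEven (n ℕ./ 2)
evalM-even n n%2≡0 with n ℕ.% 2
evalM-even n refl | zero = refl

evalM-odd : ∀ n → n ℕ.% 2 ≡ 1 → evalM n ≡ 0ℚ
evalM-odd n n%2≡1 with n ℕ.% 2
evalM-odd n refl | suc zero = refl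

evalM-double : ∀ k → evalM (2 ℕ.* k) ≡ momEven k
evalM-double k = trans (cong evalM (ℕₚ.*-comm 2 k))
  (trans (evalM-even (k ℕ.* 2) (m*n%n≡0 k 2)) (cong momEven (m*n/n≡m k 2)))

evalM-double+1 : ∀ k → evalM (suc (2 ℕ.* k)) ≡ 0ℚ
evalM-double+1 k = trans (cong (evalM ∘ suc) (ℕₚ.*-comm 2 k))
  (evalM-odd (suc (k ℕ.* 2)) ([m+kn]%n≡m%n 1 k 2))

even-or-odd : ∀ n → Σ ℕ (λ k → n ≡ 2 ℕ.* k) ⊎ Σ ℕ (λ k → n ≡ suc (2 ℕ.* k))
even-or-odd zero = inj₁ (0 , refl)
even-or-odd (suc n) with even-or-odd n
... | inj₁ (k , refl) = inj₂ (k , refl)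
... | inj₂ (k , refl) = inj₁ (suc k , sym (ℕₚ.*-suc 2 k))

evalM-suc-suc : ∀ n → evalM (suc (suc n)) ≡ fromℕ (suc n) * evalM n
evalM-suc-suc n with even-or-odd n
... | inj₁ (k , refl) = begin
  evalM (2 ℕ.+ 2 ℕ.* k)                    ≡⟨ cong evalM (ℕₚ.*-suc 2 k) ⟨
  evalM (2 ℕ.* suc k)                      ≡⟨ evalM-double (suc k) ⟩
  momEven (suc k)                          ≡⟨ momEven-suc k ⟩
  fromℕ (suc (2 ℕ.* k)) * momEven k       ≡⟨ cong (fromℕ (suc (2 ℕ.* k)) *_) (evalM-double k) ⟨
  fromℕ (suc (2 ℕ.* k)) * evalM (2 ℕ.* k) ∎
  where open ≡-Reasoning
... | inj₂ (k , refl) = begin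
  evalM (3 ℕ.+ 2 ℕ.* k)                             ≡⟨ cong (evalM ∘ suc) (ℕₚ.*-suc 2 k) ⟨
  evalM (suc (2 ℕ.* suc k))                         ≡⟨ evalM-double+1 (suc k) ⟩
  0ℚ                                                ≡⟨ *-zeroʳ (fromℕ (2 ℕ.+ 2 ℕ.* k)) ⟨
  fromℕ (2 ℕ.+ 2 ℕ.* k) * 0ℚ                        ≡⟨ cong (fromℕ (2 ℕ.+ 2 ℕ.* k) *_) (evalM-double+1 k) ⟨
  fromℕ (2 ℕ.+ 2 ℕ.* k) * evalM (suc (2 ℕ.* k))   ∎
  where open ≡-Reasoning

sumTo-cong< : ∀ n {g h : ℕ → ℚ} → (∀ i → i < n → g i ≡ h i) → sumTo n g ≡ sumTo n h
sumTo-cong< zero    g≡h = refl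
sumTo-cong< (suc n) g≡h =
  cong₂ _+_ (sumTo-cong< n (λ i i<n → g≡h i (ℕₚ.m<n⇒m<1+n i<n))) (g≡h n ℕₚ.≤-refl)

sumTo-cong : ∀ n {g h : ℕ → ℚ} → g ≗ h → sumTo n g ≡ sumTo n h
sumTo-cong n g≗h = sumTo-cong< n (λ i _ → g≗h i)

sumTo-zero : ∀ n {g : ℕ → ℚ} → (∀ i → i < n → g i ≡ 0ℚ) → sumTo n g ≡ 0ℚ
sumTo-zero zero    g≡0 = refl
sumTo-zero (suc n) g≡0 =
  cong₂ _+_ (sumTo-zero n (λ i i<n → g≡0 i (ℕₚ.m<n⇒m<1+n i<n))) (g≡0 n ℕₚ.≤-refl)

sumTo-+ : ∀ n (g h : ℕ → ℚ) → sumTo n (λ i → g i + h i) ≡ sumTo n g + sumTo n h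
sumTo-+ zero    g h = refl
sumTo-+ (suc n) g h = trans (cong (_+ (g n + h n)) (sumTo-+ n g h))
  (solve 4 (λ a b c d → (a :+ b) :+ (c :+ d) := (a :+ c) :+ (b :+ d)) refl
           (sumTo n g) (sumTo n h) (g n) (h n))
  where open +-*-Solver

sumTo-*ˡ : ∀ n c (g : ℕ → ℚ) → c * sumTo n g ≡ sumTo n (λ i → c * g i)
sumTo-*ˡ zero    c g = *-zeroʳ c
sumTo-*ˡ (suc n) c g = trans (*-distribˡ-+ c (sumTo n g) (g n)) (cong (_+ c * g n) (sumTo-*ˡ n c g))

sumTo-*ʳ : ∀ n c (g : ℕ → ℚ) → sumTo n g * c ≡ sumTo n (λ i → g i * c)
sumTo-*ʳ zero    c g = *-zeroˡ c
sumTo-*ʳ (suc n) c g = trans (*-distribʳ-+ c (sumTo n g) (g n)) (cong (_+ g n * c) (sumTo-*ʳ n c g))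

sumTo-swap : ∀ n m (F : ℕ → ℕ → ℚ) →
             sumTo n (λ i → sumTo m (F i)) ≡ sumTo m (λ j → sumTo n (λ i → F i j))
sumTo-swap zero    m F = sym (sumTo-zero m (λ _ _ → refl))
sumTo-swap (suc n) m F = trans (cong (_+ sumTo m (F n)) (sumTo-swap n m F))
  (sym (sumTo-+ m (λ j → sumTo n (λ i → F i j)) (F n)))

sumTo-suc : ∀ n (g : ℕ → ℚ) → sumTo (suc n) g ≡ g 0 + sumTo n (g ∘ suc)
sumTo-suc zero    g = trans (+-identityˡ (g 0)) (sym (+-identityʳ (g 0)))
sumTo-suc (suc n) g = trans (cong (_+ g (suc n)) (sumTo-suc n g))
  (+-assoc (g 0) (sumTo n (g ∘ suc)) (g (suc n)))

sumTo-split : ∀ c m (g : ℕ → ℚ) → sumTo (c ℕ.+ m) g ≡ sumTo c g + sumTo m (λ j → g (c ℕ.+ j))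
sumTo-split zero    m g = sym (+-identityˡ _)
sumTo-split (suc c) m g = begin
  sumTo (suc c ℕ.+ m) g                                          ≡⟨ sumTo-suc (c ℕ.+ m) g ⟩
  g 0 + sumTo (c ℕ.+ m) (g ∘ suc)                                ≡⟨ cong (_+_ (g 0)) (sumTo-split c m (g ∘ suc)) ⟩
  g 0 + (sumTo c (g ∘ suc) + sumTo m (λ j → g (suc c ℕ.+ j)))    ≡⟨ +-assoc (g 0) _ _ ⟨
  (g 0 + sumTo c (g ∘ suc)) + sumTo m (λ j → g (suc c ℕ.+ j))    ≡⟨ cong (_+ sumTo m (λ j → g (suc c ℕ.+ j))) (sumTo-suc c g) ⟨
  sumTo (suc c) g + sumTo m (λ j → g (suc c ℕ.+ j))              ∎
  where open ≡-Reasoning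

sumTo-extend : ∀ {n m} (g : ℕ → ℚ) → n ≤ m → (∀ j → n ≤ j → j < m → g j ≡ 0ℚ) →
               sumTo m g ≡ sumTo n g
sumTo-extend {n} {m} g n≤m g≡0 = begin
  sumTo m g                                       ≡⟨ cong (λ k → sumTo k g) (ℕₚ.m+[n∸m]≡n n≤m) ⟨
  sumTo (n ℕ.+ (m ∸ n)) g                         ≡⟨ sumTo-split n (m ∸ n) g ⟩
  sumTo n g + sumTo (m ∸ n) (λ j → g (n ℕ.+ j))   ≡⟨ cong (_+_ (sumTo n g)) (sumTo-zero (m ∸ n) tail≡0) ⟩
  sumTo n g + 0ℚ                                  ≡⟨ +-identityʳ (sumTo n g) ⟩
  sumTo n g                                       ∎
  where
  open ≡-Reasoning
  tail≡0 : ∀ j → j < m ∸ n → g (n ℕ.+ j) ≡ 0ℚ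
  tail≡0 j j<m∸n = g≡0 (n ℕ.+ j) (ℕₚ.m≤m+n n j)
    (ℕₚ.<-≤-trans (ℕₚ.+-monoʳ-< n j<m∸n) (ℕₚ.≤-reflexive (ℕₚ.m+[n∸m]≡n n≤m)))

sumTo-delta : ∀ n c (g : ℕ → ℚ) → c < n → (∀ i → i < n → i ≢ c → g i ≡ 0ℚ) → sumTo n g ≡ g c
sumTo-delta (suc n) c g c<1+n g≡0 with c ℕ.≟ n
... | yes refl = trans (cong (_+ g c) (sumTo-zero n (λ i i<n → g≡0 i (ℕₚ.m<n⇒m<1+n i<n) (ℕₚ.<⇒≢ i<n))))
                       (+-identityˡ (g c))
... | no c≢n = trans (cong₂ _+_ (sumTo-delta n c g (ℕₚ.≤∧≢⇒< (ℕₚ.≤-pred c<1+n) c≢n)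
                                               (λ i i<n → g≡0 i (ℕₚ.m<n⇒m<1+n i<n)))
                                (g≡0 n ℕₚ.≤-refl (c≢n ∘ sym)))
                     (+-identityʳ (g c))

sumTo-reverse : ∀ n (g : ℕ → ℚ) → sumTo n g ≡ sumTo n (λ i → g (n ∸ suc i))
sumTo-reverse zero    g = refl
sumTo-reverse (suc n) g = trans (cong (_+ g n) (sumTo-reverse n g))
  (trans (+-comm (sumTo n (λ i → g (n ∸ suc i))) (g n)) (sym (sumTo-suc n (λ i → g (n ∸ i)))))

sumTo-triangle : ∀ N (F : ℕ → ℕ → ℚ) →
                 sumTo N (λ k → sumTo (suc k) (F k)) ≡ sumTo N (λ i → sumTo (N ∸ i) (λ n → F (i ℕ.+ n) i))
sumTo-triangle zero    F = refl
sumTo-triangle (suc N) F = begin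
  sumTo N (λ k → sumTo (suc k) (F k)) + sumTo (suc N) (F N)
    ≡⟨ cong (_+ sumTo (suc N) (F N)) (sumTo-triangle N F) ⟩
  sumTo N column + sumTo (suc N) (F N)
    ≡⟨ cong (_+ sumTo (suc N) (F N)) (trans (cong (_+_ (sumTo N column)) column-last) (+-identityʳ (sumTo N column))) ⟨
  sumTo (suc N) column + sumTo (suc N) (F N)
    ≡⟨ sumTo-+ (suc N) column (F N) ⟨
  sumTo (suc N) (λ i → column i + F N i)
    ≡⟨ sumTo-cong< (suc N) (λ i i<1+N → sym (column-suc i (ℕₚ.≤-pred i<1+N))) ⟩
  sumTo (suc N) (λ i → sumTo (suc N ∸ i) (λ n → F (i ℕ.+ n) i))
    ∎
  where
  open ≡-Reasoning
  column : ℕ → ℚ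
  column i = sumTo (N ∸ i) (λ n → F (i ℕ.+ n) i)
  column-last : column N ≡ 0ℚ
  column-last = cong (λ k → sumTo k (λ n → F (N ℕ.+ n) N)) (ℕₚ.n∸n≡0 N)
  column-suc : ∀ i → i ≤ N → sumTo (suc N ∸ i) (λ n → F (i ℕ.+ n) i) ≡ column i + F N i
  column-suc i i≤N = trans (cong (λ k → sumTo k (λ n → F (i ℕ.+ n) i)) (ℕₚ.+-∸-assoc 1 i≤N))
                           (cong (λ k → column i + F k i) (ℕₚ.m+[n∸m]≡n i≤N))

⊛-congˡ : ∀ {g g′} h → g ≗ g′ → g ⊛ h ≗ g′ ⊛ h
⊛-congˡ h g≗g′ a = sumTo-cong (suc a) (λ i → cong (_* h (a ∸ i)) (g≗g′ i))

⊛-congʳ : ∀ g {h h′} → h ≗ h′ → g ⊛ h ≗ g ⊛ h′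
⊛-congʳ g h≗h′ a = sumTo-cong (suc a) (λ i → cong (g i *_) (h≗h′ (a ∸ i)))

⊛-comm : ∀ g h → g ⊛ h ≗ h ⊛ g
⊛-comm g h a = trans (sumTo-reverse (suc a) (λ i → g i * h (a ∸ i)))
  (sumTo-cong< (suc a) (λ i i<1+a → trans (*-comm (g (a ∸ i)) (h (a ∸ (a ∸ i))))
    (cong (λ j → h j * g (a ∸ i)) (ℕₚ.m∸[m∸n]≡n (ℕₚ.≤-pred i<1+a)))))

⊛-assoc : ∀ g h k → (g ⊛ h) ⊛ k ≗ g ⊛ (h ⊛ k)
⊛-assoc g h k a = begin
  sumTo (suc a) (λ i → sumTo (suc i) (λ j → g j * h (i ∸ j)) * k (a ∸ i))
    ≡⟨ sumTo-cong (suc a) (λ i → sumTo-*ʳ (suc i) (k (a ∸ i)) (λ j → g j * h (i ∸ j))) ⟩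
  sumTo (suc a) (λ i → sumTo (suc i) (λ j → g j * h (i ∸ j) * k (a ∸ i)))
    ≡⟨ sumTo-triangle (suc a) (λ i j → g j * h (i ∸ j) * k (a ∸ i)) ⟩
  sumTo (suc a) (λ j → sumTo (suc a ∸ j) (λ n → g j * h (j ℕ.+ n ∸ j) * k (a ∸ (j ℕ.+ n))))
    ≡⟨ sumTo-cong< (suc a) (λ j j<1+a → row j (ℕₚ.≤-pred j<1+a)) ⟩
  sumTo (suc a) (λ j → g j * sumTo (suc (a ∸ j)) (λ n → h n * k (a ∸ j ∸ n)))
    ∎
  where
  open ≡-Reasoning
  row : ∀ j → j ≤ a → sumTo (suc a ∸ j) (λ n → g j * h (j ℕ.+ n ∸ j) * k (a ∸ (j ℕ.+ n)))
                    ≡ g j * sumTo (suc (a ∸ j)) (λ n → h n * k (a ∸ j ∸ n))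
  row j j≤a = begin
    sumTo (suc a ∸ j) (λ n → g j * h (j ℕ.+ n ∸ j) * k (a ∸ (j ℕ.+ n)))
      ≡⟨ cong (λ m → sumTo m (λ n → g j * h (j ℕ.+ n ∸ j) * k (a ∸ (j ℕ.+ n)))) (ℕₚ.+-∸-assoc 1 j≤a) ⟩
    sumTo (suc (a ∸ j)) (λ n → g j * h (j ℕ.+ n ∸ j) * k (a ∸ (j ℕ.+ n)))
      ≡⟨ sumTo-cong (suc (a ∸ j)) (λ n →
           trans (cong₂ (λ x y → g j * h x * k y) (ℕₚ.m+n∸m≡n j n) (sym (ℕₚ.∸-+-assoc a j n)))
                 (*-assoc (g j) (h n) (k (a ∸ j ∸ n)))) ⟩
    sumTo (suc (a ∸ j)) (λ n → g j * (h n * k (a ∸ j ∸ n)))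
      ≡⟨ sumTo-*ˡ (suc (a ∸ j)) (g j) (λ n → h n * k (a ∸ j ∸ n)) ⟨
    g j * sumTo (suc (a ∸ j)) (λ n → h n * k (a ∸ j ∸ n))
      ∎

⊛-identityʳ : ∀ g → g ⊛ psOne ≗ g
⊛-identityʳ g a = trans
  (sumTo-delta (suc a) a (λ i → g i * psOne (a ∸ i)) ℕₚ.≤-refl
    (λ i i<1+a i≢a → trans (cong (g i *_) (psOne[a∸i]≡0 (ℕₚ.≤∧≢⇒< (ℕₚ.≤-pred i<1+a) i≢a))) (*-zeroʳ (g i))))
  (trans (cong (λ j → g a * psOne j) (ℕₚ.n∸n≡0 a)) (*-identityʳ (g a)))
  where
  psOne[a∸i]≡0 : ∀ {i} → i < a → psOne (a ∸ i) ≡ 0ℚ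
  psOne[a∸i]≡0 {i} i<a with a ∸ i | ℕₚ.m>n⇒m∸n≢0 i<a
  ... | zero  | a∸i≢0 = ⊥-elim (a∸i≢0 refl)
  ... | suc _ | _     = refl

⊛-identityˡ : ∀ g → psOne ⊛ g ≗ g
⊛-identityˡ g a = trans (⊛-comm psOne g a) (⊛-identityʳ g a)

scale : ℚ → PS → PS
scale c g a = c * g a

⊛-scaleʳ : ∀ c g h → g ⊛ scale c h ≗ scale c (g ⊛ h)
⊛-scaleʳ c g h a = trans
  (sumTo-cong (suc a) (λ i → solve 3 (λ c x y → x :* (c :* y) := c :* (x :* y)) refl c (g i) (h (a ∸ i))))
  (sym (sumTo-*ˡ (suc a) c (λ i → g i * h (a ∸ i))))
  where open +-*-Solver

deriv : PS → PS
deriv g a = fromℕ (suc a) * g (suc a)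

deriv-cong : ∀ {g h} → g ≗ h → deriv g ≗ deriv h
deriv-cong g≗h a = cong (fromℕ (suc a) *_) (g≗h (suc a))

deriv-psOne : ∀ a → deriv psOne a ≡ 0ℚ
deriv-psOne a = *-zeroʳ (fromℕ (suc a))

deriv-⊛ : ∀ g h a → deriv (g ⊛ h) a ≡ (deriv g ⊛ h) a + (g ⊛ deriv h) a
deriv-⊛ g h a = begin
  fromℕ (suc a) * sumTo (suc (suc a)) term
    ≡⟨ sumTo-*ˡ (suc (suc a)) (fromℕ (suc a)) term ⟩
  sumTo (suc (suc a)) (λ i → fromℕ (suc a) * term i)
    ≡⟨ sumTo-cong< (suc (suc a)) (λ i i<2+a → split-weight i (ℕₚ.≤-pred i<2+a)) ⟩
  sumTo (suc (suc a)) (λ i → fromℕ i * term i + fromℕ (suc a ∸ i) * term i)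
    ≡⟨ sumTo-+ (suc (suc a)) (λ i → fromℕ i * term i) (λ i → fromℕ (suc a ∸ i) * term i) ⟩
  sumTo (suc (suc a)) (λ i → fromℕ i * term i) + sumTo (suc (suc a)) (λ i → fromℕ (suc a ∸ i) * term i)
    ≡⟨ cong₂ _+_ differentiate-left differentiate-right ⟩
  (deriv g ⊛ h) a + (g ⊛ deriv h) a
    ∎
  where
  open ≡-Reasoning
  open +-*-Solver
  term : ℕ → ℚ
  term i = g i * h (suc a ∸ i)
  split-weight : ∀ i → i ≤ suc a → fromℕ (suc a) * term i ≡ fromℕ i * term i + fromℕ (suc a ∸ i) * term i
  split-weight i i≤1+a = trans (cong (λ n → fromℕ n * term i) (sym (ℕₚ.m+[n∸m]≡n i≤1+a)))
    (trans (cong (_* term i) (fromℕ-+ i (suc a ∸ i))) (*-distribʳ-+ (term i) (fromℕ i) (fromℕ (suc a ∸ i))))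
  differentiate-left : sumTo (suc (suc a)) (λ i → fromℕ i * term i) ≡ (deriv g ⊛ h) a
  differentiate-left = begin
    sumTo (suc (suc a)) (λ i → fromℕ i * term i)
      ≡⟨ sumTo-suc (suc a) (λ i → fromℕ i * term i) ⟩
    0ℚ * term 0 + sumTo (suc a) (λ i → fromℕ (suc i) * (g (suc i) * h (a ∸ i)))
      ≡⟨ cong (_+ sumTo (suc a) (λ i → fromℕ (suc i) * (g (suc i) * h (a ∸ i)))) (*-zeroˡ (term 0)) ⟩
    0ℚ + sumTo (suc a) (λ i → fromℕ (suc i) * (g (suc i) * h (a ∸ i)))
      ≡⟨ +-identityˡ _ ⟩
    sumTo (suc a) (λ i → fromℕ (suc i) * (g (suc i) * h (a ∸ i)))
      ≡⟨ sumTo-cong (suc a) (λ i → *-assoc (fromℕ (suc i)) (g (suc i)) (h (a ∸ i))) ⟨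
    (deriv g ⊛ h) a
      ∎
  differentiate-right : sumTo (suc (suc a)) (λ i → fromℕ (suc a ∸ i) * term i) ≡ (g ⊛ deriv h) a
  differentiate-right = begin
    sumTo (suc a) (λ i → fromℕ (suc a ∸ i) * term i) + fromℕ (suc a ∸ suc a) * term (suc a)
      ≡⟨ cong (_+_ (sumTo (suc a) (λ i → fromℕ (suc a ∸ i) * term i)))
              (trans (cong (λ n → fromℕ n * term (suc a)) (ℕₚ.n∸n≡0 a)) (*-zeroˡ (term (suc a)))) ⟩
    sumTo (suc a) (λ i → fromℕ (suc a ∸ i) * term i) + 0ℚ
      ≡⟨ +-identityʳ _ ⟩
    sumTo (suc a) (λ i → fromℕ (suc a ∸ i) * term i)
      ≡⟨ sumTo-cong< (suc a) (λ i i<1+a → trans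
           (cong (λ n → fromℕ n * (g i * h n)) (ℕₚ.+-∸-assoc 1 (ℕₚ.≤-pred i<1+a)))
           (solve 3 (λ c x y → c :* (x :* y) := x :* (c :* y)) refl
                  (fromℕ (suc (a ∸ i))) (g i) (h (suc (a ∸ i))))) ⟩
    (g ⊛ deriv h) a
      ∎

module _ {t : PS} (t′≗t³ : deriv t ≗ t ⊛ (t ⊛ t)) (t₀≡1 : t 0 ≡ 1ℚ) where

  deriv-psPow : ∀ n → deriv (psPow t n) ≗ scale (fromℕ n) (psPow t (2 ℕ.+ n))
  deriv-psPow zero    a = trans (deriv-psOne a) (sym (*-zeroˡ (psPow t 2 a)))
  deriv-psPow (suc n) a = begin
    deriv (t ⊛ psPow t n) a
      ≡⟨ deriv-⊛ t (psPow t n) a ⟩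
    (deriv t ⊛ psPow t n) a + (t ⊛ deriv (psPow t n)) a
      ≡⟨ cong₂ _+_ differentiated-factor differentiated-power ⟩
    psPow t (3 ℕ.+ n) a + fromℕ n * psPow t (3 ℕ.+ n) a
      ≡⟨ solve 2 (λ x c → x :+ c :* x := (con 1ℚ :+ c) :* x) refl (psPow t (3 ℕ.+ n) a) (fromℕ n) ⟩
    (1ℚ + fromℕ n) * psPow t (3 ℕ.+ n) a
      ≡⟨ cong (_* psPow t (3 ℕ.+ n) a) (fromℕ-+ 1 n) ⟨
    fromℕ (suc n) * psPow t (3 ℕ.+ n) a
      ∎
    where
    open ≡-Reasoning
    open +-*-Solver
    differentiated-factor : (deriv t ⊛ psPow t n) a ≡ psPow t (3 ℕ.+ n) a
    differentiated-factor =
      trans (⊛-congˡ (psPow t n) t′≗t³ a)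
      (trans (⊛-assoc t (t ⊛ t) (psPow t n) a) (⊛-congʳ t (⊛-assoc t t (psPow t n)) a))
    differentiated-power : (t ⊛ deriv (psPow t n)) a ≡ fromℕ n * psPow t (3 ℕ.+ n) a
    differentiated-power =
      trans (⊛-congʳ t (deriv-psPow n) a) (⊛-scaleʳ (fromℕ n) t (psPow t (2 ℕ.+ n)) a)

  psPow-constant : ∀ n → psPow t n 0 ≡ 1ℚ
  psPow-constant zero    = refl
  psPow-constant (suc n) = trans (+-identityˡ (t 0 * psPow t n 0)) (cong₂ _*_ t₀≡1 (psPow-constant n))

  factorial*coeff-psPow : ∀ b n → fromℕ (b !) * (evalM n * psPow t (suc n) b) ≡ evalM (2 ℕ.* b ℕ.+ n)
  factorial*coeff-psPow zero    n =
    trans (*-identityˡ _) (trans (cong (evalM n *_) (psPow-constant (suc n))) (*-identityʳ (evalM n)))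
  factorial*coeff-psPow (suc b) n = begin
    fromℕ (suc b ℕ.* b !) * (evalM n * psPow t (suc n) (suc b))
      ≡⟨ cong (_* (evalM n * psPow t (suc n) (suc b))) (fromℕ-* (suc b) (b !)) ⟩
    fromℕ (suc b) * fromℕ (b !) * (evalM n * psPow t (suc n) (suc b))
      ≡⟨ solve 4 (λ x y m p → (x :* y) :* (m :* p) := y :* (m :* (x :* p))) refl
               (fromℕ (suc b)) (fromℕ (b !)) (evalM n) (psPow t (suc n) (suc b)) ⟩
    fromℕ (b !) * (evalM n * deriv (psPow t (suc n)) b)
      ≡⟨ cong (λ x → fromℕ (b !) * (evalM n * x)) (deriv-psPow (suc n) b) ⟩
    fromℕ (b !) * (evalM n * (fromℕ (suc n) * psPow t (3 ℕ.+ n) b))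
      ≡⟨ cong (fromℕ (b !) *_) (solve 3 (λ m c p → m :* (c :* p) := (c :* m) :* p) refl
                                        (evalM n) (fromℕ (suc n)) (psPow t (3 ℕ.+ n) b)) ⟩
    fromℕ (b !) * (fromℕ (suc n) * evalM n * psPow t (3 ℕ.+ n) b)
      ≡⟨ cong (λ x → fromℕ (b !) * (x * psPow t (3 ℕ.+ n) b)) (evalM-suc-suc n) ⟨
    fromℕ (b !) * (evalM (2 ℕ.+ n) * psPow t (3 ℕ.+ n) b)
      ≡⟨ factorial*coeff-psPow b (2 ℕ.+ n) ⟩
    evalM (2 ℕ.* b ℕ.+ (2 ℕ.+ n))
      ≡⟨ cong evalM (trans (sym (ℕₚ.+-assoc (2 ℕ.* b) 2 n))
                           (cong (ℕ._+ n) (trans (ℕₚ.+-comm (2 ℕ.* b) 2) (sym (ℕₚ.*-suc 2 b))))) ⟩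
    evalM (2 ℕ.* suc b ℕ.+ n)
      ∎
    where
    open ≡-Reasoning
    open +-*-Solver

  coeff-psPow*evalM : ∀ b n → psPow t (suc n) b * evalM n ≡ invFactorial b * evalM (2 ℕ.* b ℕ.+ n)
  coeff-psPow*evalM b n = begin
    psPow t (suc n) b * evalM n
      ≡⟨ *-comm (psPow t (suc n) b) (evalM n) ⟩
    evalM n * psPow t (suc n) b
      ≡⟨ *-identityˡ _ ⟨
    1ℚ * (evalM n * psPow t (suc n) b)
      ≡⟨ cong (_* (evalM n * psPow t (suc n) b)) (invFactorial-inverseˡ b) ⟨
    invFactorial b * fromℕ (b !) * (evalM n * psPow t (suc n) b)
      ≡⟨ *-assoc (invFactorial b) (fromℕ (b !)) _ ⟩
    invFactorial b * (fromℕ (b !) * (evalM n * psPow t (suc n) b))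
      ≡⟨ cong (invFactorial b *_) (factorial*coeff-psPow b n) ⟩
    invFactorial b * evalM (2 ℕ.* b ℕ.+ n)
      ∎
    where open ≡-Reasoning

module _ {s t : PS} (s²≗1-2z : s ⊛ s ≗ oneMinus2z) (t⊛s≗1 : t ⊛ s ≗ psOne) where

  s⊛s′≗-1 : s ⊛ deriv s ≗ scale (- 1ℚ) psOne
  s⊛s′≗-1 a = begin
    (s ⊛ deriv s) a
      ≡⟨ solve 1 (λ x → x := con (+ 1 / 2) :* (x :+ x)) refl ((s ⊛ deriv s) a) ⟩
    + 1 / 2 * ((s ⊛ deriv s) a + (s ⊛ deriv s) a)
      ≡⟨ cong (λ x → + 1 / 2 * (x + (s ⊛ deriv s) a)) (⊛-comm s (deriv s) a) ⟩
    + 1 / 2 * ((deriv s ⊛ s) a + (s ⊛ deriv s) a)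
      ≡⟨ cong (+ 1 / 2 *_) (deriv-⊛ s s a) ⟨
    + 1 / 2 * deriv (s ⊛ s) a
      ≡⟨ cong (+ 1 / 2 *_) (deriv-cong s²≗1-2z a) ⟩
    + 1 / 2 * deriv oneMinus2z a
      ≡⟨ half-deriv-1-2z a ⟩
    scale (- 1ℚ) psOne a
      ∎
    where
    open ≡-Reasoning
    open +-*-Solver
    half-deriv-1-2z : ∀ a → + 1 / 2 * deriv oneMinus2z a ≡ scale (- 1ℚ) psOne a
    half-deriv-1-2z zero    = refl
    half-deriv-1-2z (suc a) = trans (cong (+ 1 / 2 *_) (*-zeroʳ (fromℕ (2 ℕ.+ a))))
                                    (trans (*-zeroʳ (+ 1 / 2)) (sym (*-zeroʳ (- 1ℚ))))

  s′≗-t : deriv s ≗ scale (- 1ℚ) t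
  s′≗-t a = begin
    deriv s a                       ≡⟨ ⊛-identityˡ (deriv s) a ⟨
    (psOne ⊛ deriv s) a             ≡⟨ ⊛-congˡ (deriv s) t⊛s≗1 a ⟨
    ((t ⊛ s) ⊛ deriv s) a           ≡⟨ ⊛-assoc t s (deriv s) a ⟩
    (t ⊛ (s ⊛ deriv s)) a           ≡⟨ ⊛-congʳ t s⊛s′≗-1 a ⟩
    (t ⊛ scale (- 1ℚ) psOne) a      ≡⟨ ⊛-scaleʳ (- 1ℚ) t psOne a ⟩
    - 1ℚ * (t ⊛ psOne) a            ≡⟨ cong (- 1ℚ *_) (⊛-identityʳ t a) ⟩
    - 1ℚ * t a                      ∎
    where open ≡-Reasoning

  t′⊛s≗t² : deriv t ⊛ s ≗ t ⊛ t
  t′⊛s≗t² a = begin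
    (deriv t ⊛ s) a
      ≡⟨ solve 2 (λ x y → x := (x :+ con (- 1ℚ) :* y) :+ y) refl ((deriv t ⊛ s) a) ((t ⊛ t) a) ⟩
    ((deriv t ⊛ s) a + - 1ℚ * (t ⊛ t) a) + (t ⊛ t) a
      ≡⟨ cong (λ x → ((deriv t ⊛ s) a + x) + (t ⊛ t) a)
              (trans (⊛-congʳ t s′≗-t a) (⊛-scaleʳ (- 1ℚ) t t a)) ⟨
    ((deriv t ⊛ s) a + (t ⊛ deriv s) a) + (t ⊛ t) a
      ≡⟨ cong (_+ (t ⊛ t) a) (deriv-⊛ t s a) ⟨
    deriv (t ⊛ s) a + (t ⊛ t) a
      ≡⟨ cong (_+ (t ⊛ t) a) (trans (deriv-cong t⊛s≗1 a) (deriv-psOne a)) ⟩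
    0ℚ + (t ⊛ t) a
      ≡⟨ +-identityˡ ((t ⊛ t) a) ⟩
    (t ⊛ t) a
      ∎
    where
    open ≡-Reasoning
    open +-*-Solver

  t′≗t³ : deriv t ≗ t ⊛ (t ⊛ t)
  t′≗t³ a = begin
    deriv t a                  ≡⟨ ⊛-identityʳ (deriv t) a ⟨
    (deriv t ⊛ psOne) a        ≡⟨ ⊛-congʳ (deriv t) (λ b → trans (⊛-comm s t b) (t⊛s≗1 b)) a ⟨
    (deriv t ⊛ (s ⊛ t)) a      ≡⟨ ⊛-assoc (deriv t) s t a ⟨
    ((deriv t ⊛ s) ⊛ t) a      ≡⟨ ⊛-congˡ t t′⊛s≗t² a ⟩
    ((t ⊛ t) ⊛ t) a            ≡⟨ ⊛-assoc t t t a ⟩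
    (t ⊛ (t ⊛ t)) a            ∎
    where open ≡-Reasoning

⊛-inverse-constant : ∀ {s t} → t ⊛ s ≗ psOne → s 0 ≡ 1ℚ → t 0 ≡ 1ℚ
⊛-inverse-constant {s} {t} t⊛s≗1 s₀≡1 = begin
  t 0             ≡⟨ *-identityʳ (t 0) ⟨
  t 0 * 1ℚ        ≡⟨ cong (t 0 *_) s₀≡1 ⟨
  t 0 * s 0       ≡⟨ +-identityˡ (t 0 * s 0) ⟨
  (t ⊛ s) 0       ≡⟨ t⊛s≗1 0 ⟩
  1ℚ              ∎
  where open ≡-Reasoning

uniformBound : ∀ {m} {f : USeries m} → Admissible f → ∀ a α →
               Σ ℕ (λ N → ∀ b → b ≤ a → ∀ n → N ≤ n → f n b α ≡ 0ℚ)
uniformBound adm zero    α = proj₁ (adm 0 α) , λ { .zero z≤n → proj₂ (adm 0 α) }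
uniformBound {f = f} adm (suc a) α = Nₐ ⊔ N , vanishes
  where
  Nₐ = proj₁ (adm (suc a) α)
  N  = proj₁ (uniformBound adm a α)
  vanishes : ∀ b → b ≤ suc a → ∀ n → Nₐ ⊔ N ≤ n → f n b α ≡ 0ℚ
  vanishes b b≤1+a n bound≤n with ℕₚ.m≤n⇒m<n∨m≡n b≤1+a
  ... | inj₁ b<1+a = proj₂ (uniformBound adm a α) b (ℕₚ.≤-pred b<1+a) n (ℕₚ.≤-trans (ℕₚ.m≤n⊔m Nₐ N) bound≤n)
  ... | inj₂ refl  = proj₂ (adm (suc a) α) n (ℕₚ.≤-trans (ℕₚ.m≤m⊔n Nₐ N) bound≤n)

zmul-vanishes : ∀ {m} g (r : R m) a α → (∀ b → b ≤ a → r b α ≡ 0ℚ) → zmul g r a α ≡ 0ℚ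
zmul-vanishes g r a α r≡0 =
  sumTo-zero (suc a) (λ i _ → trans (cong (g i *_) (r≡0 (a ∸ i) (ℕₚ.m∸n≤m a i))) (*-zeroʳ (g i)))

scaledSeries-admissible : ∀ {m} {f : USeries m} t → Admissible f → Admissible (scaledSeries t f)
scaledSeries-admissible {f = f} t adm a α = proj₁ (uniformBound adm a α) , λ n N≤n →
  zmul-vanishes t (zmul (psPow t n) (f n)) a α (λ b b≤a →
    zmul-vanishes (psPow t n) (f n) b α (λ c c≤b →
      proj₂ (uniformBound adm a α) c (ℕₚ.≤-trans c≤b b≤a) n N≤n))

expM2z-diagonal : ∀ l → expM2z (2 ℕ.* l) l ≡ invFactorial l
expM2z-diagonal l with 2 ℕ.* l ℕ.≟ 2 ℕ.* l
... | yes _    = refl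
... | no 2l≢2l = ⊥-elim (2l≢2l refl)

expM2z-offDiagonal : ∀ {i l} → i ≢ 2 ℕ.* l → expM2z i l ≡ 0ℚ
expM2z-offDiagonal {i} {l} i≢2l with i ℕ.≟ 2 ℕ.* l
... | yes i≡2l = ⊥-elim (i≢2l i≡2l)
... | no _     = refl

m+2n≤2o+m : ∀ m {n o} → n ≤ o → m ℕ.+ 2 ℕ.* n ≤ 2 ℕ.* o ℕ.+ m
m+2n≤2o+m m {n} {o} n≤o = ℕₚ.≤-trans (ℕₚ.+-monoʳ-≤ m (ℕₚ.*-monoʳ-≤ 2 n≤o)) (ℕₚ.≤-reflexive (ℕₚ.+-comm m (2 ℕ.* o)))

-- eval sums up to the bound stored in the admissibility proof; the extra suc keeps every
-- diagonal index 2l (l ≤ a) inside that range, which eval-⋆-expM2z relies on.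
⋆-expM2z-admissible : ∀ {m} {f : USeries m} → Admissible f → Admissible (expM2z ⋆ f)
⋆-expM2z-admissible {f = f} adm a α = suc (2 ℕ.* a ℕ.+ N) , λ k bound<k →
  sumTo-zero (suc k) (λ i _ → sumTo-zero (suc a) (λ l l<1+a → term-vanishes k i l (ℕₚ.≤-pred l<1+a) bound<k))
  where
  N = proj₁ (uniformBound adm a α)
  term-vanishes : ∀ k i l → l ≤ a → suc (2 ℕ.* a ℕ.+ N) ≤ k → expM2z i l * f (k ∸ i) (a ∸ l) α ≡ 0ℚ
  term-vanishes k i l l≤a bound<k = by-diagonality (i ℕ.≟ 2 ℕ.* l)
    where
    N≤k∸2l : N ≤ k ∸ 2 ℕ.* l
    N≤k∸2l = ℕₚ.m+n≤o⇒m≤o∸n N (ℕₚ.≤-trans (m+2n≤2o+m N l≤a) (ℕₚ.<⇒≤ bound<k))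
    by-diagonality : Dec (i ≡ 2 ℕ.* l) → expM2z i l * f (k ∸ i) (a ∸ l) α ≡ 0ℚ
    by-diagonality (no i≢2l)  = trans (cong (_* f (k ∸ i) (a ∸ l) α) (expM2z-offDiagonal i≢2l))
                                      (*-zeroˡ (f (k ∸ i) (a ∸ l) α))
    by-diagonality (yes refl) = trans (cong (expM2z i l *_)
      (proj₂ (uniformBound adm a α) (a ∸ l) (ℕₚ.m∸n≤m a l) (k ∸ i) N≤k∸2l)) (*-zeroʳ (expM2z i l))

expandedEval : ∀ {m} → USeries m → ℕ → ℕ → (Fin m → ℕ) → ℚ
expandedEval f N a α =
  sumTo (suc a) (λ l → sumTo N (λ n → invFactorial l * f n (a ∸ l) α * evalM (2 ℕ.* l ℕ.+ n)))

module _ {m} {f : USeries m} (adm : Admissible f) where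

  eval-⋆-expM2z : ∀ a α → eval (expM2z ⋆ f) (⋆-expM2z-admissible adm) a α
                          ≡ expandedEval f (proj₁ (uniformBound adm a α)) a α
  eval-⋆-expM2z a α = begin
    sumTo K (λ k → (expM2z ⋆ f) k a α * evalM k)
      ≡⟨ sumTo-cong K (λ k → trans (sumTo-*ʳ (suc k) (evalM k) (λ i → zmul (expM2z i) (f (k ∸ i)) a α))
           (sumTo-cong (suc k) (λ i → sumTo-*ʳ (suc a) (evalM k) (λ l → expM2z i l * f (k ∸ i) (a ∸ l) α)))) ⟩
    sumTo K (λ k → sumTo (suc k) (λ i → sumTo (suc a) (λ l → summand i l k)))
      ≡⟨ sumTo-triangle K (λ k i → sumTo (suc a) (λ l → summand i l k)) ⟩
    sumTo K (λ i → sumTo (K ∸ i) (λ n → sumTo (suc a) (λ l → summand i l (i ℕ.+ n))))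
      ≡⟨ sumTo-cong K (λ i → sumTo-swap (K ∸ i) (suc a) (λ n l → summand i l (i ℕ.+ n))) ⟩
    sumTo K (λ i → sumTo (suc a) (λ l → sumTo (K ∸ i) (λ n → summand i l (i ℕ.+ n))))
      ≡⟨ sumTo-swap K (suc a) (λ i l → sumTo (K ∸ i) (λ n → summand i l (i ℕ.+ n))) ⟩
    sumTo (suc a) (λ l → sumTo K (λ i → sumTo (K ∸ i) (λ n → summand i l (i ℕ.+ n))))
      ≡⟨ sumTo-cong< (suc a) (λ l l<1+a → diagonal-column l (ℕₚ.≤-pred l<1+a)) ⟩
    expandedEval f N a α
      ∎
    where
    open ≡-Reasoning
    N = proj₁ (uniformBound adm a α)
    K = suc (2 ℕ.* a ℕ.+ N)
    summand : ℕ → ℕ → ℕ → ℚ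
    summand i l k = expM2z i l * f (k ∸ i) (a ∸ l) α * evalM k
    diagonal-column : ∀ l → l ≤ a → sumTo K (λ i → sumTo (K ∸ i) (λ n → summand i l (i ℕ.+ n)))
                                   ≡ sumTo N (λ n → invFactorial l * f n (a ∸ l) α * evalM (2 ℕ.* l ℕ.+ n))
    diagonal-column l l≤a = begin
      sumTo K (λ i → sumTo (K ∸ i) (λ n → summand i l (i ℕ.+ n)))
        ≡⟨ sumTo-delta K (2 ℕ.* l) (λ i → sumTo (K ∸ i) (λ n → summand i l (i ℕ.+ n)))
             (s≤s (ℕₚ.≤-trans (ℕₚ.*-monoʳ-≤ 2 l≤a) (ℕₚ.m≤m+n (2 ℕ.* a) N)))
             (λ i _ i≢2l → sumTo-zero (K ∸ i) (λ n _ →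
                trans (cong (λ e → e * f (i ℕ.+ n ∸ i) (a ∸ l) α * evalM (i ℕ.+ n)) (expM2z-offDiagonal i≢2l))
                      (trans (cong (_* evalM (i ℕ.+ n)) (*-zeroˡ (f (i ℕ.+ n ∸ i) (a ∸ l) α)))
                             (*-zeroˡ (evalM (i ℕ.+ n)))))) ⟩
      sumTo (K ∸ 2 ℕ.* l) (λ n → summand (2 ℕ.* l) l (2 ℕ.* l ℕ.+ n))
        ≡⟨ sumTo-cong (K ∸ 2 ℕ.* l) (λ n →
             cong₂ (λ e j → e * f j (a ∸ l) α * evalM (2 ℕ.* l ℕ.+ n)) (expM2z-diagonal l) (ℕₚ.m+n∸m≡n (2 ℕ.* l) n)) ⟩
      sumTo (K ∸ 2 ℕ.* l) (λ n → invFactorial l * f n (a ∸ l) α * evalM (2 ℕ.* l ℕ.+ n))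
        ≡⟨ sumTo-extend (λ n → invFactorial l * f n (a ∸ l) α * evalM (2 ℕ.* l ℕ.+ n))
             (ℕₚ.m+n≤o⇒m≤o∸n N (ℕₚ.≤-trans (m+2n≤2o+m N l≤a) (ℕₚ.n≤1+n (2 ℕ.* a ℕ.+ N))))
             (λ n N≤n _ → trans (cong (λ x → invFactorial l * x * evalM (2 ℕ.* l ℕ.+ n))
                                      (proj₂ (uniformBound adm a α) (a ∸ l) (ℕₚ.m∸n≤m a l) n N≤n))
                                (trans (cong (_* evalM (2 ℕ.* l ℕ.+ n)) (*-zeroʳ (invFactorial l)))
                                       (*-zeroˡ (evalM (2 ℕ.* l ℕ.+ n))))) ⟩
      sumTo N (λ n → invFactorial l * f n (a ∸ l) α * evalM (2 ℕ.* l ℕ.+ n))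
        ∎

  eval-scaledSeries : ∀ {t} → (∀ l n → psPow t (suc n) l * evalM n ≡ invFactorial l * evalM (2 ℕ.* l ℕ.+ n)) →
                      ∀ a α → eval (scaledSeries t f) (scaledSeries-admissible t adm) a α
                              ≡ expandedEval f (proj₁ (uniformBound adm a α)) a α
  eval-scaledSeries {t} coeff*evalM a α = begin
    sumTo N (λ n → scaledSeries t f n a α * evalM n)
      ≡⟨ sumTo-cong N (λ n → cong (_* evalM n) (⊛-assoc t (psPow t n) (fₙ n) a)) ⟨
    sumTo N (λ n → (psPow t (suc n) ⊛ fₙ n) a * evalM n)
      ≡⟨ sumTo-cong N (λ n → sumTo-*ʳ (suc a) (evalM n) (λ l → psPow t (suc n) l * f n (a ∸ l) α)) ⟩
    sumTo N (λ n → sumTo (suc a) (λ l → psPow t (suc n) l * f n (a ∸ l) α * evalM n))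
      ≡⟨ sumTo-swap N (suc a) (λ n l → psPow t (suc n) l * f n (a ∸ l) α * evalM n) ⟩
    sumTo (suc a) (λ l → sumTo N (λ n → psPow t (suc n) l * f n (a ∸ l) α * evalM n))
      ≡⟨ sumTo-cong (suc a) (λ l → sumTo-cong N (λ n → rearrange l n)) ⟩
    expandedEval f N a α
      ∎
    where
    open ≡-Reasoning
    open +-*-Solver
    N = proj₁ (uniformBound adm a α)
    fₙ : ℕ → PS
    fₙ n b = f n b α
    rearrange : ∀ l n → psPow t (suc n) l * f n (a ∸ l) α * evalM n
                      ≡ invFactorial l * f n (a ∸ l) α * evalM (2 ℕ.* l ℕ.+ n)
    rearrange l n = begin
      psPow t (suc n) l * f n (a ∸ l) α * evalM n
        ≡⟨ solve 3 (λ p x μ → p :* x :* μ := x :* (p :* μ)) refl (psPow t (suc n) l) (f n (a ∸ l) α) (evalM n) ⟩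
      f n (a ∸ l) α * (psPow t (suc n) l * evalM n)
        ≡⟨ cong (f n (a ∸ l) α *_) (coeff*evalM l n) ⟩
      f n (a ∸ l) α * (invFactorial l * evalM (2 ℕ.* l ℕ.+ n))
        ≡⟨ solve 3 (λ x c μ → x :* (c :* μ) := c :* x :* μ) refl (f n (a ∸ l) α) (invFactorial l) (evalM (2 ℕ.* l ℕ.+ n)) ⟩
      invFactorial l * f n (a ∸ l) α * evalM (2 ℕ.* l ℕ.+ n)
        ∎

mainTheorem3 : (m : ℕ) (f : USeries m) → Admissible f →
    (s t : PS) → (∀ a → (s ⊛ s) a ≡ oneMinus2z a) → s 0 ≡ 1ℚ →
    (∀ a → (t ⊛ s) a ≡ psOne a) →
    Σ (Admissible (expM2z ⋆ f)) (λ hL →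
      Σ (Admissible (scaledSeries t f)) (λ hR →
        ∀ a α → eval (expM2z ⋆ f) hL a α ≡ eval (scaledSeries t f) hR a α))
mainTheorem3 m f adm s t s²≗1-2z s₀≡1 t⊛s≗1 =
  ⋆-expM2z-admissible adm , scaledSeries-admissible t adm , λ a α →
    trans (eval-⋆-expM2z adm a α) (sym (eval-scaledSeries adm {t} coeff*evalM a α))
  where
  coeff*evalM : ∀ l n → psPow t (suc n) l * evalM n ≡ invFactorial l * evalM (2 ℕ.* l ℕ.+ n)
  coeff*evalM = coeff-psPow*evalM {t} (t′≗t³ {s} {t} s²≗1-2z t⊛s≗1) (⊛-inverse-constant {s} {t} t⊛s≗1 s₀≡1)
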